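{- The class of finite L$_1$-models is a Hennessy-Milner class: for all finite L$_1$-models $\mathfrak{M}=(W,1,\curlywedge,V)$, $\mathfrak{M}'=(W',1',\curlywedge',V')$ and states $w\in W$, $w'\in W'$, we have $\mathrm{th}_{\mathfrak{M}}(w)\subseteq\mathrm{th}_{\mathfrak{M}'}(w')$ if and only if there exists an L$_1$-simulation $S$ from $\mathfrak{M}$ to $\mathfrak{M}'$ with $(w,w')\in S$.
   Context: $\mathcal{L}$ is generated by $\phi ::= p\mid\top\mid\bot\mid\phi\wedge\phi\mid\phi\vee\phi$, $p$ in a fixed set $\mathrm{Prop}$. A meet-semilattice $(W,1,\curlywedge)$ is a poset in which every finite subset has a meet; $\curlywedge$ binary meet, $1$ top, $w\preccurlyeq v$ iff $w\curlywedge v=w$. A filter is a $\preccurlyeq$-upward closed subset closed under finite meets. An L$_1$-model $(W,1,\curlywedge,V)$ is a meet-semilattice with $V(p)$ a filter for each $p\in\mathrm{Prop}$; it is finite if $W$ is finite. Satisfaction: $w\Vdash p$ iff $w\in V(p)$; $w\Vdash\top$ always; $w\Vdash\bot$ iff $w=1$; $\wedge$ classical; $w\Vdash\phi_1\vee\phi_2$ iff there are $u,v$ with $u\curlywedge v\preccurlyeq w$, $u\Vdash\phi_1$, $v\Vdash\phi_2$. $\mathrm{th}_{\mathfrak{M}}(w)=\{\phi\in\mathcal{L}\mid\mathfrak{M},w\Vdash\phi\}$. An L$_1$-simulation from $\mathfrak{M}$ to $\mathfrak{M}'$ is $S\subseteq W\times W'$ such that for all $(w,w')\in S$: (S1) $w\in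 V(p)$ implies $w'\in V'(p)$ for all $p$; (S2) $w=1$ implies $w'=1'$; (S3) if $v\curlywedge u\preccurlyeq w$ then there exist $v',u'\in W'$ with $(v,v'),(u,u')\in S$ and $v'\curlywedge'u'\preccurlyeq' w'$. -}

module Defs where

open import Level using (0ℓ)
open import Data.Nat using (ℕ)
open import Data.Fin using (Fin)
open import Data.Product using (Σ; ∃; ∃-syntax; _×_; _,_)
open import Data.Unit using (⊤)
open import Relation.Binary.PropositionalEquality using (_≡_)
open import Function.Bundles using (_↔_)

data Form (Prop : Set) : Set where
  var  : Prop → Form Prop
  ⊤'   : Form Prop
  ⊥'   : Form Prop
  _∧'_ : Form Prop → Form Prop → Form Prop
  _∨'_ : Form Prop → Form Prop → Form Prop

-- A meet-semilattice (W, 1, ⋏) with top 1, with equality the propositional one.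
-- Every finite subset has a meet: binary meets plus top (empty meet).
record MeetSemilattice : Set₁ where
  field
    W      : Set
    one    : W
    _⋏_    : W → W → W
    ⋏-assoc : ∀ x y z → (x ⋏ y) ⋏ z ≡ x ⋏ (y ⋏ z)
    ⋏-comm  : ∀ x y → x ⋏ y ≡ y ⋏ x
    ⋏-idem  : ∀ x → x ⋏ x ≡ x
    ⋏-one   : ∀ x → x ⋏ one ≡ x

  _≼_ : W → W → Set
  w ≼ v = w ⋏ v ≡ w

record IsFilter (L : MeetSemilattice) (F : MeetSemilattice.W L → Set) : Set where
  open MeetSemilattice L
  field
    upward  : ∀ {w v} → w ≼ v → F w → F v
    has-one : F one
    meet    : ∀ {w v} → F w → F v → F (w ⋏ v)

record Model (Prop : Set) : Set₁ where
  field
    lat      : MeetSemilattice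
  open MeetSemilattice lat public
  field
    V        : Prop → W → Set
    V-filter : ∀ p → IsFilter lat (V p)

Finite : ∀ {Prop} → Model Prop → Set
Finite M = ∃[ n ] (Model.W M ↔ Fin n)

_,_⊩_ : ∀ {Prop} (M : Model Prop) → Model.W M → Form Prop → Set
M , w ⊩ var p   = Model.V M p w
M , w ⊩ ⊤'      = ⊤
M , w ⊩ ⊥'      = w ≡ Model.one M
M , w ⊩ (φ ∧' ψ) = (M , w ⊩ φ) × (M , w ⊩ ψ)
M , w ⊩ (φ ∨' ψ) =
  ∃[ u ] ∃[ v ] (Model._≼_ M (Model._⋏_ M u v) w × (M , u ⊩ φ) × (M , v ⊩ ψ))

ThIncl : ∀ {Prop} (M M' : Model Prop) → Model.W M → Model.W M' → Set
ThIncl M M' w w' = ∀ φ → M , w ⊩ φ → M' , w' ⊩ φ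

record IsSimulation {Prop : Set} (M M' : Model Prop)
                    (S : Model.W M → Model.W M' → Set) : Set where
  field
    S1 : ∀ {w w'} → S w w' → ∀ p → Model.V M p w → Model.V M' p w'
    S2 : ∀ {w w'} → S w w' → w ≡ Model.one M → w' ≡ Model.one M'
    S3 : ∀ {w w'} → S w w' → ∀ {v u} → Model._≼_ M (Model._⋏_ M v u) w →
         ∃[ v' ] ∃[ u' ] (S v v' × S u u' × Model._≼_ M' (Model._⋏_ M' v' u') w')

-- A simulation preserves every formula, by induction on the formula.
-- Conversely, theory inclusion is itself a simulation once M' is finite: for
-- each state v of M, excluded middle yields for every state z of M' a formula
-- true at v and false at z unless th(v) ⊆ th(z), and the conjunction of these
-- finitely many formulas characterises th(v) inside M'.  Clause (S3) then
-- follows by evaluating the disjunction of the characteristic formulas of v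
-- and u at w'.
module Submission where

open import Defs
open import Axiom.ExcludedMiddle using (ExcludedMiddle)
open import Data.Fin using (Fin; zero; suc)
open import Data.Nat using (ℕ)
open import Data.Product using (Σ; ∃-syntax; _×_; _,_; proj₁; proj₂)
open import Data.Unit using (tt)
open import Function.Bundles using (_⇔_; mk⇔; Inverse)
open import Level using (0ℓ)
open import Relation.Binary.PropositionalEquality using (_≡_; subst; sym)
open import Relation.Nullary using (¬_; yes; no; contradiction)
open import Relation.Nullary.Decidable using (decidable-stable)

module _ {Prop : Set} where

  ⋀ : ∀ {n} → (Fin n → Form Prop) → Form Prop
  ⋀ {ℕ.zero}  φ = ⊤'
  ⋀ {ℕ.suc n} φ = φ zero ∧' ⋀ (λ i → φ (suc i))

  module _ (M : Model Prop) {w : Model.W M} where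

    ⊩-⋀⁺ : ∀ {n} {φ : Fin n → Form Prop} → (∀ i → M , w ⊩ φ i) → M , w ⊩ ⋀ φ
    ⊩-⋀⁺ {ℕ.zero}  h = tt
    ⊩-⋀⁺ {ℕ.suc n} h = h zero , ⊩-⋀⁺ (λ i → h (suc i))

    ⊩-⋀⁻ : ∀ {n} {φ : Fin n → Form Prop} → M , w ⊩ ⋀ φ → ∀ i → M , w ⊩ φ i
    ⊩-⋀⁻ (h , _) zero    = h
    ⊩-⋀⁻ (_ , h) (suc i) = ⊩-⋀⁻ h i

  module _ (M M' : Model Prop) where

    simulation⇒ThIncl : ∀ {S} → IsSimulation M M' S →
                        ∀ {w w'} → S w w' → ThIncl M M' w w'
    simulation⇒ThIncl sim s (var p)   h = IsSimulation.S1 sim s p h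
    simulation⇒ThIncl sim s ⊤'        h = tt
    simulation⇒ThIncl sim s ⊥'        h = IsSimulation.S2 sim s h
    simulation⇒ThIncl sim s (φ ∧' ψ) (hφ , hψ) =
      simulation⇒ThIncl sim s φ hφ , simulation⇒ThIncl sim s ψ hψ
    simulation⇒ThIncl sim s (φ ∨' ψ) (u , v , uv≼w , hφ , hψ) =
      let u' , v' , su , sv , u'v'≼w' = IsSimulation.S3 sim s uv≼w
      in  u' , v' , u'v'≼w' , simulation⇒ThIncl sim su φ hφ , simulation⇒ThIncl sim sv ψ hψ

    module _ (lem : ExcludedMiddle 0ℓ) where

      separator : ∀ v z → Σ (Form Prop) λ φ →
                  M , v ⊩ φ × (M' , z ⊩ φ → ThIncl M M' v z)
      separator v z with lem {∃[ φ ] (M , v ⊩ φ × ¬ (M' , z ⊩ φ))}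
      ... | yes (φ , vφ , ¬zφ) = φ , vφ , λ zφ → contradiction zφ ¬zφ
      ... | no ¬separated      = ⊤' , tt , λ _ ψ vψ →
        decidable-stable lem (λ ¬zψ → ¬separated (ψ , vψ , ¬zψ))

      characteristic : Finite M' → ∀ v → Σ (Form Prop) λ φ →
                       M , v ⊩ φ × (∀ z → M' , z ⊩ φ → ThIncl M M' v z)
      characteristic (n , W'↔Fin) v =
        ⋀ χ , ⊩-⋀⁺ M (λ i → proj₁ (proj₂ (separator v (from i)))) , th⊆
        where
        open Inverse W'↔Fin using (to; from; strictlyInverseʳ)
        χ : Fin n → Form Prop
        χ i = proj₁ (separator v (from i))
        th⊆ : ∀ z → M' , z ⊩ ⋀ χ → ThIncl M M' v z
        th⊆ z h = subst (ThIncl M M' v) from-to-z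
                    (proj₂ (proj₂ (separator v (from (to z))))
                      (subst (M' ,_⊩ χ (to z)) (sym from-to-z) (⊩-⋀⁻ M' h (to z))))
          where
          from-to-z : from (to z) ≡ z
          from-to-z = strictlyInverseʳ z

      ThIncl-isSimulation : Finite M' → IsSimulation M M' (ThIncl M M')
      ThIncl-isSimulation finite = record
        { S1 = λ th p → th (var p)
        ; S2 = λ th → th ⊥'
        ; S3 = λ th {v} {u} vu≼w →
            let φ , vφ , th-φ = characteristic finite v
                ψ , uψ , th-ψ = characteristic finite u
                v' , u' , v'u'≼w' , v'φ , u'ψ = th (φ ∨' ψ) (v , u , vu≼w , vφ , uψ)
            in  v' , u' , th-φ v' v'φ , th-ψ u' u'ψ , v'u'≼w'
        }

proposition5p2 : ExcludedMiddle 0ℓ → {Prop : Set} (M M' : Model Prop) →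
    Finite M → Finite M' → (w : Model.W M) (w' : Model.W M') →
    ThIncl M M' w w' ⇔
      (∃[ S ] (IsSimulation M M' S × S w w'))
proposition5p2 lem M M' _ finite' w w' = mk⇔
  (λ th → ThIncl M M' , ThIncl-isSimulation M M' lem finite' , th)
  (λ (S , sim , s) → simulation⇒ThIncl M M' sim s)
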